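{- The tableau calculus $\mathbf{TAB}_{\mathbf{IB}}$ has the termination property: for every tableau of $\mathbf{TAB}_{\mathbf{IB}}$, every branch of it is finite.
   Context: Hybrid language: fix disjoint countably infinite sets $\mathbf{Prop}$ (propositional variables) and $\mathbf{Nom}$ (nominals). Formulas: $\varphi ::= p \mid i \mid \neg\varphi \mid \varphi\land\varphi \mid \diamondsuit\varphi \mid @_i\varphi$ with $p\in\mathbf{Prop}$, $i\in\mathbf{Nom}$; $\square\varphi$ abbreviates $\neg\diamondsuit\neg\varphi$. Tableaux of $\mathbf{TAB}_{\mathbf{IB}}$: a tableau is a well-founded tree of formulas of the form $@_i\varphi$, started from a root formula $@_i\varphi$ where $i$ does not occur in $\varphi$. Each branch (maximal path) is extended by applying the rules below as often as possible, except that nothing more is added to a branch once it is closed, or once every formula that any rule could generate already occurs on it. A branch $\Theta$ is closed if $@_i\varphi, @_i\neg\varphi\in\Theta$ for some $i,\varphi$. Rules (premises already on the branch, conclusions added to it): [$\neg\neg$] from $@_i\neg\neg\varphi$ add $@_i\varphi$; [$\land$] from $@_i(\varphi\land\psi)$ add $@_i\varphi$ and $@_i\psi$; [$\neg\land$] from $@_i\neg(\varphi\land\psi)$ split the branch into one branch with $@_i\neg\varphi$ and one with $@_i\neg\psi$; [$\diamondsuit$] from $@_i\diamondsuit\varphi$ add $@_i\diamondsuit j$ and $@_j\varphi$, where $j$ is a nominal not yet occurring on the branch, the rule is applied at most once per formula, the premise is not an accessibility formula, and (restriction $\mathcal{D}$) $i$ is a quasi-urfather on the branch; [$\neg\diamondsuit$]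 from $@_i\neg\diamondsuit\varphi$ and $@_i\diamondsuit j$ add $@_j\neg\varphi$; [$@$] from $@_i@_j\varphi$ add $@_j\varphi$; [$\neg@$] from $@_i\neg@_j\varphi$ add $@_j\neg\varphi$; [$\mathit{Id}$] from $@_i\varphi$ and $@_i j$ add $@_j\varphi$, provided $@_i\varphi$ is not an accessibility formula; [$\mathit{Ref}$] add $@_i i$ for any nominal $i$ occurring on the branch; [$\square_{\mathit{sym}}$] from $@_i\square\varphi$ and $@_j\diamondsuit i$ add $@_j\varphi$; ($\mathcal{I}$) for every nominal $i$ occurring on the branch add $@_i\neg\diamondsuit i$. An accessibility formula is a formula $@_i\diamondsuit j$ added by [$\diamondsuit$] with $j$ new. Auxiliary notions for a branch $\Theta$: $@_i\varphi$ is a quasi-subformula of $@_j\psi$ if $\varphi$ is a subformula of $\psi$, or $\varphi=\neg\chi$ with $\chi$ a subformula of $\psi$. $T^\Theta(i)=\{\varphi \mid @_i\varphi\in\Theta$ and $@_i\varphi$ is a quasi-subformula of the root formula$\}$. Nominals $i,j$ are twins in $\Theta$ if $T^\Theta(i)=T^\Theta(j)$. $i\prec_\Theta j$ if $j$ was introduced by applying [$\diamondsuit$] to a formula $@_i\diamondsuit\varphi$; $\prec_\Theta^*$ is its reflexive transitive closure. A nominal $i$ is a quasi-urfather on $\Theta$ if there are no twins $j\neq k$ with $j\prec_\Theta^* i$ and $k\prec_\Theta^* i$. -}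

module Defs where

open import Data.Nat using (ℕ; suc)
open import Data.Product using (Σ; ∃; ∃-syntax; _×_; _,_; proj₁; proj₂)
open import Data.Sum using (_⊎_)
open import Data.List using (List; []; _∷_; _++_)
open import Data.List.Membership.Propositional using (_∈_)
open import Data.List.Relation.Unary.Any using (Any)
open import Data.List.Relation.Unary.All using (All)
open import Relation.Binary.PropositionalEquality using (_≡_; _≢_)
open import Relation.Binary.Construct.Closure.ReflexiveTransitive using (Star)
open import Relation.Nullary using (¬_)
open import Data.Empty using (⊥)

-- Hybrid formulas.  Prop and Nom are both ℕ, kept disjoint by the
-- constructors `prop` and `nom`.

Nom : Set
Nom = ℕ

data Form : Set where
  prop : ℕ → Form
  nom  : Nom → Form
  ¬'_  : Form → Form
  _∧'_ : Form → Form → Form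
  ◇_   : Form → Form
  at   : Nom → Form → Form

□_ : Form → Form
□ φ = ¬' (◇ (¬' φ))

data _⊑_ : Form → Form → Set where
  ⊑-refl : ∀ {φ} → φ ⊑ φ
  ⊑-¬    : ∀ {φ ψ} → φ ⊑ ψ → φ ⊑ (¬' ψ)
  ⊑-∧ˡ   : ∀ {φ ψ χ} → φ ⊑ ψ → φ ⊑ (ψ ∧' χ)
  ⊑-∧ʳ   : ∀ {φ ψ χ} → φ ⊑ χ → φ ⊑ (ψ ∧' χ)
  ⊑-◇    : ∀ {φ ψ} → φ ⊑ ψ → φ ⊑ (◇ ψ)
  ⊑-at   : ∀ {φ ψ j} → φ ⊑ ψ → φ ⊑ (at j ψ)

data NomIn (i : Nom) : Form → Set where
  in-nom : NomIn i (nom i)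
  in-¬   : ∀ {φ} → NomIn i φ → NomIn i (¬' φ)
  in-∧ˡ  : ∀ {φ ψ} → NomIn i φ → NomIn i (φ ∧' ψ)
  in-∧ʳ  : ∀ {φ ψ} → NomIn i ψ → NomIn i (φ ∧' ψ)
  in-◇   : ∀ {φ} → NomIn i φ → NomIn i (◇ φ)
  in-atˡ : ∀ {φ} → NomIn i (at i φ)
  in-atʳ : ∀ {j φ} → NomIn i φ → NomIn i (at j φ)

-- Tableau formulas @_i φ are represented as pairs (i , φ).

LForm : Set
LForm = Nom × Form

NomInL : Nom → LForm → Set
NomInL i (j , φ) = i ≡ j ⊎ NomIn i φ

-- A record (i , φ , j) says: [◇] was applied to @_i ◇ φ, introducing j.
DiaRec : Set
DiaRec = Nom × Form × Nom

-- The state of a branch: the formulas on it, and the history of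
-- applications of the [◇] rule (needed for accessibility formulas,
-- "applied at most once per formula", and the relation ≺).
record Branch : Set where
  constructor mkBranch
  field
    formulas : List LForm
    diaApps  : List DiaRec
open Branch public

_∈B_ : LForm → Branch → Set
x ∈B Θ = x ∈ formulas Θ

OnBranch : Nom → Branch → Set
OnBranch i Θ = Any (NomInL i) (formulas Θ)

Closed : Branch → Set
Closed Θ = ∃[ i ] ∃[ φ ] ((i , φ) ∈B Θ × (i , ¬' φ) ∈B Θ)

AccFormula : Branch → LForm → Set
AccFormula Θ (i , ψ) = ∃[ φ ] ∃[ j ] (ψ ≡ ◇ (nom j) × (i , φ , j) ∈ diaApps Θ)

_≺[_]_ : Nom → Branch → Nom → Set
i ≺[ Θ ] j = ∃[ φ ] ((i , φ , j) ∈ diaApps Θ)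

_≺*[_]_ : Nom → Branch → Nom → Set
i ≺*[ Θ ] j = Star (λ a b → a ≺[ Θ ] b) i j

QuasiSub : LForm → Form → Set
QuasiSub root φ = φ ⊑ proj₂ root ⊎ ∃[ χ ] (φ ≡ ¬' χ × χ ⊑ proj₂ root)

InT : LForm → Branch → Nom → Form → Set
InT root Θ i φ = (i , φ) ∈B Θ × QuasiSub root φ

Twins : LForm → Branch → Nom → Nom → Set
Twins root Θ i j = ∀ φ → (InT root Θ i φ → InT root Θ j φ) × (InT root Θ j φ → InT root Θ i φ)

QuasiUrfather : LForm → Branch → Nom → Set
QuasiUrfather root Θ i =
  ¬ (∃[ j ] ∃[ k ] (j ≢ k × Twins root Θ j k × j ≺*[ Θ ] i × k ≺*[ Θ ] i))

-- Non-[◇] rules: `Rule Θ cs` means some rule instance is applicable on Θ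
-- with list of conclusions cs (the branching rule [¬∧] gives two
-- alternatives, one for each new branch).

data Rule (Θ : Branch) : List LForm → Set where
  r-¬¬  : ∀ {i φ} → (i , ¬' (¬' φ)) ∈B Θ → Rule Θ ((i , φ) ∷ [])
  r-∧   : ∀ {i φ ψ} → (i , φ ∧' ψ) ∈B Θ → Rule Θ ((i , φ) ∷ (i , ψ) ∷ [])
  r-¬∧₁ : ∀ {i φ ψ} → (i , ¬' (φ ∧' ψ)) ∈B Θ → Rule Θ ((i , ¬' φ) ∷ [])
  r-¬∧₂ : ∀ {i φ ψ} → (i , ¬' (φ ∧' ψ)) ∈B Θ → Rule Θ ((i , ¬' ψ) ∷ [])
  r-¬◇  : ∀ {i j φ} → (i , ¬' (◇ φ)) ∈B Θ → (i , ◇ (nom j)) ∈B Θ →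
          Rule Θ ((j , ¬' φ) ∷ [])
  r-at  : ∀ {i j φ} → (i , at j φ) ∈B Θ → Rule Θ ((j , φ) ∷ [])
  r-¬at : ∀ {i j φ} → (i , ¬' (at j φ)) ∈B Θ → Rule Θ ((j , ¬' φ) ∷ [])
  r-Id  : ∀ {i j φ} → (i , φ) ∈B Θ → (i , nom j) ∈B Θ →
          ¬ AccFormula Θ (i , φ) → Rule Θ ((j , φ) ∷ [])
  r-Ref : ∀ {i} → OnBranch i Θ → Rule Θ ((i , nom i) ∷ [])
  r-□sym : ∀ {i j φ} → (i , □ φ) ∈B Θ → (j , ◇ (nom i)) ∈B Θ →
          Rule Θ ((j , φ) ∷ [])
  r-I   : ∀ {i} → OnBranch i Θ → Rule Θ ((i , ¬' (◇ (nom i))) ∷ [])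

data Step (root : LForm) : Branch → Branch → Set where
  step-rule : ∀ {Θ cs} → ¬ Closed Θ → Rule Θ cs →
              ¬ All (λ x → x ∈B Θ) cs →
              Step root Θ (mkBranch (formulas Θ ++ cs) (diaApps Θ))
  step-◇    : ∀ {Θ i φ j} → ¬ Closed Θ →
              (i , ◇ φ) ∈B Θ →
              ¬ AccFormula Θ (i , ◇ φ) →
              (∀ k → ¬ ((i , φ , k) ∈ diaApps Θ)) →
              QuasiUrfather root Θ i →
              ¬ OnBranch j Θ →
              Step root Θ (mkBranch (formulas Θ ++ (i , ◇ (nom j)) ∷ (j , φ) ∷ [])
                                    ((i , φ , j) ∷ diaApps Θ))

initial : LForm → Branch
initial root = mkBranch (root ∷ []) []

InfiniteBranch : LForm → Set
InfiniteBranch root =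
  Σ (ℕ → Branch) λ Θ → (Θ 0 ≡ initial root) × (∀ n → Step root (Θ n) (Θ (suc n)))

-- Every formula on a branch has the form @n ψ, where n is a nominal on the branch and ψ is a
-- quasi-subformula of the root, one of k, ¬k, ¬◇k for a nominal k on the branch, or an
-- accessibility formula ◇k.  The nominals on a branch form a forest under ≺ rooted at the
-- nominals of the root formula.  [◇] always introduces a fresh nominal and is applied at most
-- once per formula, so a nominal is determined by its root together with the formulas of the
-- [◇]-applications along its lineage.  [◇] is only applied at quasi-urfathers.  The ancestors
-- of a quasi-urfather are pairwise non-twins, so they have pairwise different sets T(i), and
-- this bounds the depth of the forest.  Hence only finitely many formulas can occur on a
-- branch, while every step adds a new one.
module Submission where

open import Defs
open import Data.Nat using (ℕ; zero; suc; _+_; _*_; _≤_; _<_; z≤n; s≤s)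
open import Data.Nat.Properties
  using (1+n≰n; m≤n⇒m≤1+n; ≤-refl; *-mono-≤; *-monoʳ-≤; +-monoʳ-≤; module ≤-Reasoning)
  renaming (_≟_ to _≟ℕ_)
open import Data.Product using (∃₂; ∃-syntax; _×_; _,_; proj₁; proj₂)
import Data.Product.Properties as Product
open import Data.Sum using (inj₁; inj₂; [_,_]′)
open import Data.List
  using (List; []; _∷_; _++_; map; length; filter; cartesianProduct; cartesianProductWith)
open import Data.List.Properties using (length-++; length-map; length-filter; length-removeAt′)
open import Data.List.Membership.Propositional using (_∈_; _∉_; _─_; find; lose)
open import Data.List.Membership.Propositional.Properties
  using ( ∈-++⁺ˡ; ∈-++⁺ʳ; ∈-++⁻; ∈-map⁺; ∈-filter⁺; ∈-filter⁻
        ; ∈-cartesianProduct⁺; ∈-cartesianProductWith⁺)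
open import Data.List.Relation.Binary.Subset.Propositional using (_⊆_)
open import Data.List.Relation.Unary.Any using (Any; here; there; index)
import Data.List.Relation.Unary.Any.Properties as Any
open import Data.List.Relation.Unary.All as All using (All; []; _∷_)
open import Data.List.Relation.Unary.All.Properties using (¬Any⇒All¬; ¬All⇒Any¬)
open import Data.List.Relation.Unary.Unique.Propositional using (Unique; []; _∷_)
open import Relation.Binary.Construct.Closure.ReflexiveTransitive using (Star; ε; _◅_; _◅◅_)
open import Relation.Binary.Definitions using (DecidableEquality)
open import Relation.Binary.PropositionalEquality
  using (_≡_; _≢_; refl; sym; trans; cong; cong₂; subst; module ≡-Reasoning)
open import Relation.Nullary using (¬_; Dec; yes; no)
open import Relation.Nullary.Decidable using (map′; _×-dec_)
open import Data.Empty using (⊥-elim)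
open import Function using (_∘_; _$_)

module _ {A : Set} where

  ∈-─⁺ : ∀ {x z : A} {ys} (x∈ys : x ∈ ys) → z ∈ ys → z ≢ x → z ∈ ys ─ x∈ys
  ∈-─⁺ (here refl)  (here refl)  z≢x = ⊥-elim (z≢x refl)
  ∈-─⁺ (here refl)  (there z∈ys) _   = z∈ys
  ∈-─⁺ (there x∈ys) (here refl)  _   = here refl
  ∈-─⁺ (there x∈ys) (there z∈ys) z≢x = there (∈-─⁺ x∈ys z∈ys z≢x)

  lists≤ : ℕ → List A → List (List A)
  lists≤ zero    xs = [] ∷ []
  lists≤ (suc n) xs = [] ∷ cartesianProductWith _∷_ xs (lists≤ n xs)

  ∈-lists≤⁺ : ∀ n {xs ys : List A} → length ys ≤ n → ys ⊆ xs → ys ∈ lists≤ n xs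
  ∈-lists≤⁺ zero    {ys = []}     _            _     = here refl
  ∈-lists≤⁺ (suc n) {ys = []}     _            _     = here refl
  ∈-lists≤⁺ (suc n) {ys = y ∷ ys} (s≤s |ys|≤n) ys⊆xs =
    there (∈-cartesianProductWith⁺ _∷_ (ys⊆xs (here refl)) (∈-lists≤⁺ n |ys|≤n (ys⊆xs ∘ there)))

pigeonhole : ∀ {A B : Set} (R : A → B → Set) {xs : List A} {ys : List B} → Unique xs →
             (∀ {x} → x ∈ xs → ∃[ y ] (y ∈ ys × R x y)) →
             (∀ {x x′ y} → x ∈ xs → x′ ∈ xs → R x y → R x′ y → x ≡ x′) →
             length xs ≤ length ys
pigeonhole R [] _ _ = z≤n
pigeonhole R {x ∷ xs} {ys} (x∉xs ∷ xs-unique) image injective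
  with y , y∈ys , Rxy ← image (here refl) = begin
    suc (length xs)          ≤⟨ s≤s (pigeonhole R xs-unique image′ injective′) ⟩
    suc (length (ys ─ y∈ys)) ≡⟨ length-removeAt′ ys (index y∈ys) ⟨
    length ys                ∎
  where
  open ≤-Reasoning
  image′ : ∀ {z} → z ∈ xs → ∃[ y′ ] (y′ ∈ ys ─ y∈ys × R z y′)
  image′ z∈xs with y′ , y′∈ys , Rzy′ ← image (there z∈xs) =
    y′ , ∈-─⁺ y∈ys y′∈ys (λ { refl → All.lookup x∉xs z∈xs (injective (here refl) (there z∈xs) Rxy Rzy′) })
       , Rzy′
  injective′ : ∀ {z z′ y′} → z ∈ xs → z′ ∈ xs → R z y′ → R z′ y′ → z ≡ z′
  injective′ z∈xs z′∈xs = injective (there z∈xs) (there z′∈xs)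

length-cartesianProductWith : ∀ {A B C : Set} (f : A → B → C) xs ys →
                              length (cartesianProductWith f xs ys) ≡ length xs * length ys
length-cartesianProductWith f []       ys = refl
length-cartesianProductWith f (x ∷ xs) ys = begin
  length (map (f x) ys ++ cartesianProductWith f xs ys)
    ≡⟨ length-++ (map (f x) ys) ⟩
  length (map (f x) ys) + length (cartesianProductWith f xs ys)
    ≡⟨ cong₂ _+_ (length-map (f x) ys) (length-cartesianProductWith f xs ys) ⟩
  length ys + length xs * length ys
    ∎
  where open ≡-Reasoning

_≟ᶠ_ : DecidableEquality Form
prop p   ≟ᶠ prop q   = map′ (cong prop) (λ { refl → refl }) (p ≟ℕ q)
nom i    ≟ᶠ nom j    = map′ (cong nom) (λ { refl → refl }) (i ≟ℕ j)
(¬' φ)   ≟ᶠ (¬' ψ)   = map′ (cong ¬'_) (λ { refl → refl }) (φ ≟ᶠ ψ)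
(φ ∧' ψ) ≟ᶠ (χ ∧' ξ) = map′ (λ (e , e′) → cong₂ _∧'_ e e′) (λ { refl → refl , refl }) (φ ≟ᶠ χ ×-dec ψ ≟ᶠ ξ)
(◇ φ)    ≟ᶠ (◇ ψ)    = map′ (cong ◇_) (λ { refl → refl }) (φ ≟ᶠ ψ)
at i φ   ≟ᶠ at j ψ   = map′ (λ (e , e′) → cong₂ at e e′) (λ { refl → refl , refl }) (i ≟ℕ j ×-dec φ ≟ᶠ ψ)
prop _   ≟ᶠ nom _    = no λ ()
prop _   ≟ᶠ (¬' _)   = no λ ()
prop _   ≟ᶠ (_ ∧' _) = no λ ()
prop _   ≟ᶠ (◇ _)    = no λ ()
prop _   ≟ᶠ at _ _   = no λ ()
nom _    ≟ᶠ prop _   = no λ ()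
nom _    ≟ᶠ (¬' _)   = no λ ()
nom _    ≟ᶠ (_ ∧' _) = no λ ()
nom _    ≟ᶠ (◇ _)    = no λ ()
nom _    ≟ᶠ at _ _   = no λ ()
(¬' _)   ≟ᶠ prop _   = no λ ()
(¬' _)   ≟ᶠ nom _    = no λ ()
(¬' _)   ≟ᶠ (_ ∧' _) = no λ ()
(¬' _)   ≟ᶠ (◇ _)    = no λ ()
(¬' _)   ≟ᶠ at _ _   = no λ ()
(_ ∧' _) ≟ᶠ prop _   = no λ ()
(_ ∧' _) ≟ᶠ nom _    = no λ ()
(_ ∧' _) ≟ᶠ (¬' _)   = no λ ()
(_ ∧' _) ≟ᶠ (◇ _)    = no λ ()
(_ ∧' _) ≟ᶠ at _ _   = no λ ()
(◇ _)    ≟ᶠ prop _   = no λ ()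
(◇ _)    ≟ᶠ nom _    = no λ ()
(◇ _)    ≟ᶠ (¬' _)   = no λ ()
(◇ _)    ≟ᶠ (_ ∧' _) = no λ ()
(◇ _)    ≟ᶠ at _ _   = no λ ()
at _ _   ≟ᶠ prop _   = no λ ()
at _ _   ≟ᶠ nom _    = no λ ()
at _ _   ≟ᶠ (¬' _)   = no λ ()
at _ _   ≟ᶠ (_ ∧' _) = no λ ()
at _ _   ≟ᶠ (◇ _)    = no λ ()

_≟ˡ_ : DecidableEquality LForm
_≟ˡ_ = Product.≡-dec _≟ℕ_ _≟ᶠ_

open import Data.List.Membership.DecPropositional _≟ˡ_ using (_∈?_)

⊑-trans : ∀ {φ ψ χ} → φ ⊑ ψ → ψ ⊑ χ → φ ⊑ χ
⊑-trans φ⊑ψ ⊑-refl   = φ⊑ψ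
⊑-trans φ⊑ψ (⊑-¬ p)  = ⊑-¬ (⊑-trans φ⊑ψ p)
⊑-trans φ⊑ψ (⊑-∧ˡ p) = ⊑-∧ˡ (⊑-trans φ⊑ψ p)
⊑-trans φ⊑ψ (⊑-∧ʳ p) = ⊑-∧ʳ (⊑-trans φ⊑ψ p)
⊑-trans φ⊑ψ (⊑-◇ p)  = ⊑-◇ (⊑-trans φ⊑ψ p)
⊑-trans φ⊑ψ (⊑-at p) = ⊑-at (⊑-trans φ⊑ψ p)

subformulas strictSubformulas : Form → List Form
subformulas φ = φ ∷ strictSubformulas φ

strictSubformulas (prop _) = []
strictSubformulas (nom _)  = []
strictSubformulas (¬' φ)   = subformulas φ
strictSubformulas (φ ∧' ψ) = subformulas φ ++ subformulas ψ
strictSubformulas (◇ φ)    = subformulas φ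
strictSubformulas (at _ φ) = subformulas φ

∈-subformulas⁺ : ∀ {φ ψ} → φ ⊑ ψ → φ ∈ subformulas ψ
∈-subformulas⁺ ⊑-refl                 = here refl
∈-subformulas⁺ (⊑-¬ p)                = there (∈-subformulas⁺ p)
∈-subformulas⁺ (⊑-∧ˡ p)               = there (∈-++⁺ˡ (∈-subformulas⁺ p))
∈-subformulas⁺ {ψ = ψ ∧' _} (⊑-∧ʳ p) = there (∈-++⁺ʳ (subformulas ψ) (∈-subformulas⁺ p))
∈-subformulas⁺ (⊑-◇ p)                = there (∈-subformulas⁺ p)
∈-subformulas⁺ (⊑-at p)               = there (∈-subformulas⁺ p)

nominals : Form → List Nom
nominals (prop _) = []
nominals (nom i)  = i ∷ []
nominals (¬' φ)   = nominals φ
nominals (φ ∧' ψ) = nominals φ ++ nominals ψ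
nominals (◇ φ)    = nominals φ
nominals (at i φ) = i ∷ nominals φ

∈-nominals⁺ : ∀ {x φ} → NomIn x φ → x ∈ nominals φ
∈-nominals⁺ in-nom                 = here refl
∈-nominals⁺ (in-¬ p)               = ∈-nominals⁺ p
∈-nominals⁺ (in-∧ˡ p)              = ∈-++⁺ˡ (∈-nominals⁺ p)
∈-nominals⁺ {φ = φ ∧' _} (in-∧ʳ p) = ∈-++⁺ʳ (nominals φ) (∈-nominals⁺ p)
∈-nominals⁺ (in-◇ p)               = ∈-nominals⁺ p
∈-nominals⁺ in-atˡ                 = here refl
∈-nominals⁺ (in-atʳ p)             = there (∈-nominals⁺ p)

module Forests (IsRoot : Nom → Set) (labels : List Form) (depth : ℕ) where

  children : List DiaRec → List Nom
  children = map (proj₂ ∘ proj₂)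

  data Node (rs : List DiaRec) (x : Nom) : Set where
    is-root  : IsRoot x → Node rs x
    is-child : x ∈ children rs → Node rs x

  child-node : ∀ {rs i φ x} → (i , φ , x) ∈ rs → Node rs x
  child-node = is-child ∘ ∈-map⁺ (proj₂ ∘ proj₂)

  -- The formulas p of the [◇]-applications leading from the root b to x are listed last first.
  data Lineage (rs : List DiaRec) (b : Nom) : Nom → List Form → Set where
    origin : IsRoot b → Lineage rs b b []
    child  : ∀ {i φ x p} → (i , φ , x) ∈ rs → Lineage rs b i p → Lineage rs b x (φ ∷ p)

  data Forest : List DiaRec → Set where
    []   : Forest []
    grow : ∀ {rs i φ j} → Forest rs →
           Node rs i → ¬ Node rs j → (∀ k → (i , φ , k) ∉ rs) → φ ∈ labels →
           (∀ {b p} → Lineage rs b i p → length p < depth) →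
           Forest ((i , φ , j) ∷ rs)

  module _ {r : DiaRec} {rs : List DiaRec} where

    Node-weaken : ∀ {x} → Node rs x → Node (r ∷ rs) x
    Node-weaken (is-root x-root) = is-root x-root
    Node-weaken (is-child x∈rs)  = is-child (there x∈rs)

    Lineage-weaken : ∀ {b x p} → Lineage rs b x p → Lineage (r ∷ rs) b x p
    Lineage-weaken (origin b-root) = origin b-root
    Lineage-weaken (child m l)     = child (there m) (Lineage-weaken l)

  lineage-root : ∀ {rs b x p} → Lineage rs b x p → IsRoot b
  lineage-root (origin b-root) = b-root
  lineage-root (child _ l)     = lineage-root l

  child-not-root : ∀ {rs i φ x} → Forest rs → (i , φ , x) ∈ rs → ¬ IsRoot x
  child-not-root (grow _ _ j-new _ _ _) (here refl) = j-new ∘ is-root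
  child-not-root (grow F _ _ _ _ _)     (there m)   = child-not-root F m

  parent-unique : ∀ {rs i i′ φ φ′ x} → Forest rs → (i , φ , x) ∈ rs → (i′ , φ′ , x) ∈ rs →
                  (i , φ) ≡ (i′ , φ′)
  parent-unique _                      (here refl) (here refl) = refl
  parent-unique (grow _ _ j-new _ _ _) (here refl) (there m′)  = ⊥-elim (j-new (child-node m′))
  parent-unique (grow _ _ j-new _ _ _) (there m)   (here refl) = ⊥-elim (j-new (child-node m))
  parent-unique (grow F _ _ _ _ _)     (there m)   (there m′)  = parent-unique F m m′

  child-unique : ∀ {rs i φ x y} → Forest rs → (i , φ , x) ∈ rs → (i , φ , y) ∈ rs → x ≡ y
  child-unique _                     (here refl) (here refl) = refl
  child-unique (grow _ _ _ once _ _) (here refl) (there m′)  = ⊥-elim (once _ m′)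
  child-unique (grow _ _ _ once _ _) (there m)   (here refl) = ⊥-elim (once _ m)
  child-unique (grow F _ _ _ _ _)    (there m)   (there m′)  = child-unique F m m′

  children-unique : ∀ {rs} → Forest rs → Unique (children rs)
  children-unique []                     = []
  children-unique (grow F _ j-new _ _ _) = ¬Any⇒All¬ _ (j-new ∘ is-child) ∷ children-unique F

  lineage-injective : ∀ {rs b x y p} → Forest rs → Lineage rs b x p → Lineage rs b y p → x ≡ y
  lineage-injective F (origin _)  (origin _)    = refl
  lineage-injective F (child m l) (child m′ l′) with refl ← lineage-injective F l l′ =
    child-unique F m m′

  lineage-unique : ∀ {rs b b′ x p p′} → Forest rs → Lineage rs b x p → Lineage rs b′ x p′ → p ≡ p′
  lineage-unique F (origin _)      (origin _)      = refl
  lineage-unique F (origin x-root) (child m′ _)    = ⊥-elim (child-not-root F m′ x-root)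
  lineage-unique F (child m _)     (origin x-root) = ⊥-elim (child-not-root F m x-root)
  lineage-unique F (child m l)     (child m′ l′) with refl ← parent-unique F m m′ =
    cong (_ ∷_) (lineage-unique F l l′)

  members : ∀ {rs b x p} → Lineage rs b x p → List Nom
  members {x = x} (origin _)  = x ∷ []
  members {x = x} (child _ l) = x ∷ members l

  length-members : ∀ {rs b x p} (l : Lineage rs b x p) → length (members l) ≡ suc (length p)
  length-members (origin _)  = refl
  length-members (child _ l) = cong suc (length-members l)

  members-≺* : ∀ {rs b x p a} (l : Lineage rs b x p) → a ∈ members l →
               Star (λ u v → ∃[ φ ] ((u , φ , v) ∈ rs)) a x
  members-≺* (origin _)  (here refl) = ε
  members-≺* (child _ _) (here refl) = ε
  members-≺* (child m l) (there a∈)  = members-≺* l a∈ ◅◅ (_ , m) ◅ ε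

  member-lineage : ∀ {rs b x p a} (l : Lineage rs b x p) → a ∈ members l →
                   ∃[ q ] (Lineage rs b a q × length q ≤ length p)
  member-lineage l@(origin _)  (here refl) = _ , l , ≤-refl
  member-lineage l@(child _ _) (here refl) = _ , l , ≤-refl
  member-lineage (child _ l)   (there a∈)  =
    let q , l′ , q≤p = member-lineage l a∈ in q , l′ , m≤n⇒m≤1+n q≤p

  members-unique : ∀ {rs b x p} → Forest rs → (l : Lineage rs b x p) → Unique (members l)
  members-unique F (origin _)     = [] ∷ []
  members-unique F l@(child _ l′) = All.tabulate x∉ ∷ members-unique F l′
    where
    x∉ : ∀ {a} → a ∈ members l′ → _ ≢ a
    x∉ a∈ refl = let q , l″ , q≤p = member-lineage l′ a∈ in
      1+n≰n (subst (λ q → length q ≤ _) (sym (lineage-unique F l l″)) q≤p)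

  lineage-of : ∀ {rs x} → Forest rs → Node rs x →
               ∃₂ λ b p → Lineage rs b x p × length p ≤ depth × p ⊆ labels
  lineage-of _ (is-root x-root) = _ , [] , origin x-root , z≤n , λ ()
  lineage-of (grow F i-node _ _ φ∈ shallow) (is-child (here refl)) =
    let b , p , l , _ , p⊆ = lineage-of F i-node in
    b , _ ∷ p , child (here refl) (Lineage-weaken l) , shallow l ,
    λ { (here refl) → φ∈ ; (there ψ∈) → p⊆ ψ∈ }
  lineage-of (grow F _ _ _ _ _) (is-child (there x∈)) =
    let b , p , l , p≤ , p⊆ = lineage-of F (is-child x∈) in
    b , p , Lineage-weaken l , p≤ , p⊆

  forest-size : ∀ {rs} (roots : List Nom) → (∀ {x} → IsRoot x → x ∈ roots) → Forest rs →
                length rs ≤ length (cartesianProduct roots (lists≤ depth labels))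
  forest-size {rs} roots ∈-roots F =
    subst (_≤ _) (length-map _ rs)
      (pigeonhole (λ x k → Lineage rs (proj₁ k) x (proj₂ k)) (children-unique F) key
                  (λ _ _ → lineage-injective F))
    where
    key : ∀ {x} → x ∈ children rs →
          ∃[ k ] (k ∈ cartesianProduct roots (lists≤ depth labels) × Lineage rs (proj₁ k) x (proj₂ k))
    key x∈ = let b , p , l , p≤ , p⊆ = lineage-of F (is-child x∈) in
      (b , p) , ∈-cartesianProduct⁺ (∈-roots (lineage-root l)) (∈-lists≤⁺ depth p≤ p⊆) , l

module Termination (i₀ : Nom) (φ₀ : Form) where

  root : LForm
  root = i₀ , φ₀

  quasiSubformulas : List Form
  quasiSubformulas = subformulas φ₀ ++ map ¬'_ (subformulas φ₀)

  ∈-quasiSubformulas⁺ : ∀ {φ} → QuasiSub root φ → φ ∈ quasiSubformulas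
  ∈-quasiSubformulas⁺ (inj₁ φ⊑φ₀) = ∈-++⁺ˡ (∈-subformulas⁺ φ⊑φ₀)
  ∈-quasiSubformulas⁺ (inj₂ (_ , refl , χ⊑φ₀)) =
    ∈-++⁺ʳ (subformulas φ₀) (∈-map⁺ ¬'_ (∈-subformulas⁺ χ⊑φ₀))

  labelled? : ∀ Θ a ψ → Dec ((a , ψ) ∈B Θ)
  labelled? Θ a ψ = (a , ψ) ∈? formulas Θ

  -- T^Θ(a), as a sublist of the quasi-subformulas.
  signature : Branch → Nom → List Form
  signature Θ a = filter (labelled? Θ a) quasiSubformulas

  same-signature⇒twins : ∀ {Θ a b} → signature Θ a ≡ signature Θ b → Twins root Θ a b
  same-signature⇒twins {Θ} eq φ = transfer eq , transfer (sym eq)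
    where
    transfer : ∀ {a b} → signature Θ a ≡ signature Θ b → InT root Θ a φ → InT root Θ b φ
    transfer {a} {b} eq (aφ∈Θ , φ-quasi) =
      let φ∈sig-a = ∈-filter⁺ (labelled? Θ a) (∈-quasiSubformulas⁺ φ-quasi) aφ∈Θ in
      proj₂ (∈-filter⁻ (labelled? Θ b) (subst (φ ∈_) eq φ∈sig-a)) , φ-quasi

  signature∈ : ∀ Θ a → signature Θ a ∈ lists≤ (length quasiSubformulas) quasiSubformulas
  signature∈ Θ a =
    ∈-lists≤⁺ _ (length-filter (labelled? Θ a) quasiSubformulas) (proj₁ ∘ ∈-filter⁻ (labelled? Θ a))

  maxDepth : ℕ
  maxDepth = length (lists≤ (length quasiSubformulas) quasiSubformulas)

  open Forests (λ x → NomInL x root) (subformulas φ₀) maxDepth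

  quasiUrfather-shallow : ∀ {Θ i b p} → Forest (diaApps Θ) → QuasiUrfather root Θ i →
                          Lineage (diaApps Θ) b i p → length p < maxDepth
  quasiUrfather-shallow {Θ} F urfather l =
    subst (_≤ maxDepth) (length-members l)
      (pigeonhole (λ a s → signature Θ a ≡ s) (members-unique F l)
                  (λ _ → _ , signature∈ Θ _ , refl) no-twins)
    where
    no-twins : ∀ {a a′ s} → a ∈ members l → a′ ∈ members l →
               signature Θ a ≡ s → signature Θ a′ ≡ s → a ≡ a′
    no-twins {a} {a′} a∈ a′∈ refl eq with a ≟ℕ a′
    ... | yes a≡a′ = a≡a′
    ... | no  a≢a′ = ⊥-elim (urfather ( a , a′ , a≢a′ , same-signature⇒twins {Θ} (sym eq)
                                      , members-≺* l a∈ , members-≺* l a′∈))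

  -- ¬nominal is needed because [¬◇] turns the (I)-formula @i ¬◇i into @j ¬i.
  data Closure (rs : List DiaRec) : LForm → Set where
    sub           : ∀ {n φ} → φ ⊑ φ₀ → Closure rs (n , φ)
    ¬sub          : ∀ {n φ} → φ ⊑ φ₀ → Closure rs (n , ¬' φ)
    nominal       : ∀ {n k} → Closure rs (n , nom k)
    ¬nominal      : ∀ {n k} → Closure rs (n , ¬' nom k)
    irreflexive   : ∀ {n k} → Closure rs (n , ¬' (◇ nom k))
    accessibility : ∀ {n φ k} → (n , φ , k) ∈ rs → Closure rs (n , ◇ nom k)

  Closure-weaken : ∀ {r rs x} → Closure rs x → Closure (r ∷ rs) x
  Closure-weaken (sub p)           = sub p
  Closure-weaken (¬sub p)          = ¬sub p
  Closure-weaken nominal           = nominal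
  Closure-weaken ¬nominal          = ¬nominal
  Closure-weaken irreflexive       = irreflexive
  Closure-weaken (accessibility m) = accessibility (there m)

  Closure-relabel : ∀ {Θ i j φ} → Closure (diaApps Θ) (i , φ) → ¬ AccFormula Θ (i , φ) →
                    Closure (diaApps Θ) (j , φ)
  Closure-relabel (sub p)           _    = sub p
  Closure-relabel (¬sub p)          _    = ¬sub p
  Closure-relabel nominal           _    = nominal
  Closure-relabel ¬nominal          _    = ¬nominal
  Closure-relabel irreflexive       _    = irreflexive
  Closure-relabel (accessibility m) ¬acc = ⊥-elim (¬acc (_ , _ , refl , m))

  conclusions-closed : ∀ {Θ cs} → (∀ {x} → x ∈B Θ → Closure (diaApps Θ) x) → Rule Θ cs →
                       All (Closure (diaApps Θ)) cs
  conclusions-closed closed (r-¬¬ m) with closed m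
  ... | sub p  = sub (⊑-trans (⊑-¬ (⊑-¬ ⊑-refl)) p) ∷ []
  ... | ¬sub p = sub (⊑-trans (⊑-¬ ⊑-refl) p) ∷ []
  conclusions-closed closed (r-∧ m) with closed m
  ... | sub p = sub (⊑-trans (⊑-∧ˡ ⊑-refl) p) ∷ sub (⊑-trans (⊑-∧ʳ ⊑-refl) p) ∷ []
  conclusions-closed closed (r-¬∧₁ m) with closed m
  ... | sub p  = ¬sub (⊑-trans (⊑-¬ (⊑-∧ˡ ⊑-refl)) p) ∷ []
  ... | ¬sub p = ¬sub (⊑-trans (⊑-∧ˡ ⊑-refl) p) ∷ []
  conclusions-closed closed (r-¬∧₂ m) with closed m
  ... | sub p  = ¬sub (⊑-trans (⊑-¬ (⊑-∧ʳ ⊑-refl)) p) ∷ []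
  ... | ¬sub p = ¬sub (⊑-trans (⊑-∧ʳ ⊑-refl) p) ∷ []
  conclusions-closed closed (r-¬◇ m _) with closed m
  ... | sub p       = ¬sub (⊑-trans (⊑-¬ (⊑-◇ ⊑-refl)) p) ∷ []
  ... | ¬sub p      = ¬sub (⊑-trans (⊑-◇ ⊑-refl) p) ∷ []
  ... | irreflexive = ¬nominal ∷ []
  conclusions-closed closed (r-at m) with closed m
  ... | sub p = sub (⊑-trans (⊑-at ⊑-refl) p) ∷ []
  conclusions-closed closed (r-¬at m) with closed m
  ... | sub p  = ¬sub (⊑-trans (⊑-¬ (⊑-at ⊑-refl)) p) ∷ []
  ... | ¬sub p = ¬sub (⊑-trans (⊑-at ⊑-refl) p) ∷ []
  conclusions-closed {Θ} closed (r-Id m _ ¬acc) = Closure-relabel {Θ} (closed m) ¬acc ∷ []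
  conclusions-closed closed (r-Ref _) = nominal ∷ []
  conclusions-closed closed (r-□sym m _) with closed m
  ... | sub p  = sub (⊑-trans (⊑-¬ (⊑-◇ (⊑-¬ ⊑-refl))) p) ∷ []
  ... | ¬sub p = sub (⊑-trans (⊑-◇ (⊑-¬ ⊑-refl)) p) ∷ []
  conclusions-closed closed (r-I _) = irreflexive ∷ []

  NominalsOn : List LForm → LForm → Set
  NominalsOn F c = ∀ {x} → NomInL x c → Any (NomInL x) F

  label-occurs : ∀ {F : List LForm} {i ψ} → (i , ψ) ∈ F → Any (NomInL i) F
  label-occurs m = lose m (inj₁ refl)

  nominal-occurs : ∀ {F : List LForm} {i ψ x} → (i , ψ) ∈ F → NomIn x ψ → Any (NomInL x) F
  nominal-occurs m x∈ψ = lose m (inj₂ x∈ψ)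

  nominalsOn : ∀ {F j φ} → Any (NomInL j) F → (∀ {x} → NomIn x φ → Any (NomInL x) F) →
               NominalsOn F (j , φ)
  nominalsOn j-on _    (inj₁ refl) = j-on
  nominalsOn _    φ-on (inj₂ x∈φ)  = φ-on x∈φ

  conclusions-nominals : ∀ {Θ cs} → Rule Θ cs → All (NominalsOn (formulas Θ)) cs
  conclusions-nominals (r-¬¬ m) =
    nominalsOn (label-occurs m) (nominal-occurs m ∘ in-¬ ∘ in-¬) ∷ []
  conclusions-nominals (r-∧ m) =
    nominalsOn (label-occurs m) (nominal-occurs m ∘ in-∧ˡ) ∷
    nominalsOn (label-occurs m) (nominal-occurs m ∘ in-∧ʳ) ∷ []
  conclusions-nominals (r-¬∧₁ m) =
    nominalsOn (label-occurs m) (λ { (in-¬ x∈φ) → nominal-occurs m (in-¬ (in-∧ˡ x∈φ)) }) ∷ []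
  conclusions-nominals (r-¬∧₂ m) =
    nominalsOn (label-occurs m) (λ { (in-¬ x∈ψ) → nominal-occurs m (in-¬ (in-∧ʳ x∈ψ)) }) ∷ []
  conclusions-nominals (r-¬◇ m m′) =
    nominalsOn (nominal-occurs m′ (in-◇ in-nom))
               (λ { (in-¬ x∈φ) → nominal-occurs m (in-¬ (in-◇ x∈φ)) }) ∷ []
  conclusions-nominals (r-at m) =
    nominalsOn (nominal-occurs m in-atˡ) (nominal-occurs m ∘ in-atʳ) ∷ []
  conclusions-nominals (r-¬at m) =
    nominalsOn (nominal-occurs m (in-¬ in-atˡ))
               (λ { (in-¬ x∈φ) → nominal-occurs m (in-¬ (in-atʳ x∈φ)) }) ∷ []
  conclusions-nominals (r-Id m m′ _) =
    nominalsOn (nominal-occurs m′ in-nom) (nominal-occurs m) ∷ []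
  conclusions-nominals (r-Ref i-on) =
    nominalsOn i-on (λ { in-nom → i-on }) ∷ []
  conclusions-nominals (r-□sym m m′) =
    nominalsOn (label-occurs m′) (nominal-occurs m ∘ in-¬ ∘ in-◇ ∘ in-¬) ∷ []
  conclusions-nominals (r-I i-on) =
    nominalsOn i-on (λ { (in-¬ (in-◇ in-nom)) → i-on }) ∷ []

  record Invariant (Θ : Branch) : Set where
    field
      forest      : Forest (diaApps Θ)
      closed      : ∀ {x} → x ∈B Θ → Closure (diaApps Θ) x
      node-occurs : ∀ {x} → Node (diaApps Θ) x → OnBranch x Θ
      occurs-node : ∀ {x} → OnBranch x Θ → Node (diaApps Θ) x

  invariant-initial : Invariant (initial root)
  invariant-initial = record
    { forest      = []
    ; closed      = λ { (here refl) → sub ⊑-refl }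
    ; node-occurs = λ { (is-root x-root) → here x-root }
    ; occurs-node = λ { (here x-root) → is-root x-root }
    }

  invariant-rule : ∀ {Θ cs} → Rule Θ cs → Invariant Θ →
                   Invariant (mkBranch (formulas Θ ++ cs) (diaApps Θ))
  invariant-rule {Θ} {cs} r I = record
    { forest      = forest
    ; closed      = [ closed , All.lookup (conclusions-closed closed r) ]′ ∘ ∈-++⁻ (formulas Θ)
    ; node-occurs = Any.++⁺ˡ ∘ node-occurs
    ; occurs-node = [ occurs-node , occurs-node ∘ conclusion-occurs ]′ ∘ Any.++⁻ (formulas Θ)
    }
    where
    open Invariant I
    conclusion-occurs : ∀ {x} → Any (NomInL x) cs → OnBranch x Θ
    conclusion-occurs x∈cs =
      let c , c∈cs , x∈c = find x∈cs in All.lookup (conclusions-nominals r) c∈cs x∈c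

  invariant-◇ : ∀ {Θ i φ j} → (i , ◇ φ) ∈B Θ → ¬ AccFormula Θ (i , ◇ φ) →
                (∀ k → (i , φ , k) ∉ diaApps Θ) → QuasiUrfather root Θ i → ¬ OnBranch j Θ →
                Invariant Θ →
                Invariant (mkBranch (formulas Θ ++ (i , ◇ (nom j)) ∷ (j , φ) ∷ [])
                                    ((i , φ , j) ∷ diaApps Θ))
  invariant-◇ {Θ} {i} {φ} {j} m ¬acc once urfather j-new I = record
    { forest      = grow forest i-node (j-new ∘ node-occurs) once (∈-subformulas⁺ φ⊑φ₀)
                         (quasiUrfather-shallow forest urfather)
    ; closed      = closed′
    ; node-occurs = node-occurs′
    ; occurs-node = occurs-node′
    }
    where
    open Invariant I
    new = (i , ◇ (nom j)) ∷ (j , φ) ∷ []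
    rs′ = (i , φ , j) ∷ diaApps Θ

    φ⊑φ₀ : φ ⊑ φ₀
    φ⊑φ₀ with closed m
    ... | sub ◇φ⊑φ₀         = ⊑-trans (⊑-◇ ⊑-refl) ◇φ⊑φ₀
    ... | accessibility m′ = ⊥-elim (¬acc (_ , _ , refl , m′))

    i-node : Node (diaApps Θ) i
    i-node = occurs-node (label-occurs m)

    closed′ : ∀ {x} → x ∈ formulas Θ ++ new → Closure rs′ x
    closed′ x∈ with ∈-++⁻ (formulas Θ) x∈
    ... | inj₁ x∈Θ                 = Closure-weaken (closed x∈Θ)
    ... | inj₂ (here refl)         = accessibility (here refl)
    ... | inj₂ (there (here refl)) = sub φ⊑φ₀

    node-occurs′ : ∀ {x} → Node rs′ x → Any (NomInL x) (formulas Θ ++ new)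
    node-occurs′ (is-root x-root)        = Any.++⁺ˡ (node-occurs (is-root x-root))
    node-occurs′ (is-child (here refl))  = Any.++⁺ʳ (formulas Θ) (there (here (inj₁ refl)))
    node-occurs′ (is-child (there x∈rs)) = Any.++⁺ˡ (node-occurs (is-child x∈rs))

    occurs-node′ : ∀ {x} → Any (NomInL x) (formulas Θ ++ new) → Node rs′ x
    occurs-node′ x-on with Any.++⁻ (formulas Θ) x-on
    ... | inj₁ x-on-Θ                      = Node-weaken (occurs-node x-on-Θ)
    ... | inj₂ (here (inj₁ refl))          = Node-weaken i-node
    ... | inj₂ (here (inj₂ (in-◇ in-nom))) = is-child (here refl)
    ... | inj₂ (there (here (inj₁ refl)))  = is-child (here refl)
    ... | inj₂ (there (here (inj₂ x∈φ)))   = Node-weaken (occurs-node (nominal-occurs m (in-◇ x∈φ)))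

  invariant-step : ∀ {Θ Θ′} → Step root Θ Θ′ → Invariant Θ → Invariant Θ′
  invariant-step (step-rule _ r _)                     = invariant-rule r
  invariant-step (step-◇ _ m ¬acc once urfather j-new) = invariant-◇ m ¬acc once urfather j-new

  step-adds : ∀ {Θ Θ′} → Step root Θ Θ′ → ∃[ x ] (x ∉ formulas Θ × x ∈ formulas Θ′)
  step-adds (step-rule {Θ} {cs} _ _ not-all) =
    let c , c∈cs , c∉Θ = find (¬All⇒Any¬ (_∈? formulas Θ) cs not-all) in
    c , c∉Θ , ∈-++⁺ʳ (formulas Θ) c∈cs
  step-adds (step-◇ {Θ} _ _ _ _ _ j-new) =
    _ , j-new ∘ label-occurs , ∈-++⁺ʳ (formulas Θ) (there (here refl))

  step-⊆ : ∀ {Θ Θ′} → Step root Θ Θ′ → formulas Θ ⊆ formulas Θ′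
  step-⊆ (step-rule _ _ _)    = ∈-++⁺ˡ
  step-⊆ (step-◇ _ _ _ _ _ _) = ∈-++⁺ˡ

  roots : List Nom
  roots = i₀ ∷ nominals φ₀

  ∈-roots⁺ : ∀ {x} → NomInL x root → x ∈ roots
  ∈-roots⁺ (inj₁ refl)  = here refl
  ∈-roots⁺ (inj₂ x∈φ₀) = there (∈-nominals⁺ x∈φ₀)

  nodes : List DiaRec → List Nom
  nodes rs = roots ++ children rs

  ∈-nodes⁺ : ∀ {rs x} → Node rs x → x ∈ nodes rs
  ∈-nodes⁺ (is-root x-root) = ∈-++⁺ˡ (∈-roots⁺ x-root)
  ∈-nodes⁺ (is-child x∈rs)  = ∈-++⁺ʳ roots x∈rs

  nominalShapes : List (Nom → Form)
  nominalShapes = nom ∷ (¬'_ ∘ nom) ∷ (¬'_ ∘ ◇_ ∘ nom) ∷ (◇_ ∘ nom) ∷ []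

  shapes : List Nom → List Form
  shapes ns = quasiSubformulas ++ cartesianProductWith _$_ nominalShapes ns

  universe : List Nom → List LForm
  universe ns = cartesianProduct ns (shapes ns)

  length-universe : ∀ ns →
                    length (universe ns) ≡ length ns * (length quasiSubformulas + 4 * length ns)
  length-universe ns = begin
    length (universe ns)
      ≡⟨ length-cartesianProductWith _,_ ns (shapes ns) ⟩
    length ns * length (shapes ns)
      ≡⟨ cong (length ns *_) (length-++ quasiSubformulas) ⟩
    length ns * (length quasiSubformulas + length (cartesianProductWith _$_ nominalShapes ns))
      ≡⟨ cong (λ n → length ns * (length quasiSubformulas + n))
              (length-cartesianProductWith _$_ nominalShapes ns) ⟩
    length ns * (length quasiSubformulas + 4 * length ns)
      ∎
    where open ≡-Reasoning

  in-universe : ∀ {Θ} → Invariant Θ → formulas Θ ⊆ universe (nodes (diaApps Θ))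
  in-universe {Θ} I {n , ψ} m =
    ∈-cartesianProduct⁺ (∈-nodes⁺ (occurs-node (label-occurs m))) (shape (closed m))
    where
    open Invariant I
    nominal∈ : ∀ {k} → NomIn k ψ → k ∈ nodes (diaApps Θ)
    nominal∈ = ∈-nodes⁺ ∘ occurs-node ∘ nominal-occurs m
    shaped : ∀ {s k} → s ∈ nominalShapes → k ∈ nodes (diaApps Θ) → s k ∈ shapes (nodes (diaApps Θ))
    shaped s∈ k∈ = ∈-++⁺ʳ quasiSubformulas (∈-cartesianProductWith⁺ _$_ s∈ k∈)
    shape : Closure (diaApps Θ) (n , ψ) → ψ ∈ shapes (nodes (diaApps Θ))
    shape (sub p)           = ∈-++⁺ˡ (∈-quasiSubformulas⁺ (inj₁ p))
    shape (¬sub p)          = ∈-++⁺ˡ (∈-quasiSubformulas⁺ (inj₂ (_ , refl , p)))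
    shape nominal           = shaped (here refl) (nominal∈ in-nom)
    shape ¬nominal          = shaped (there (here refl)) (nominal∈ (in-¬ in-nom))
    shape irreflexive       = shaped (there (there (here refl))) (nominal∈ (in-¬ (in-◇ in-nom)))
    shape (accessibility _) = shaped (there (there (there (here refl)))) (nominal∈ (in-◇ in-nom))

  maxNodes : ℕ
  maxNodes = length roots + length (cartesianProduct roots (lists≤ maxDepth (subformulas φ₀)))

  maxFormulas : ℕ
  maxFormulas = maxNodes * (length quasiSubformulas + 4 * maxNodes)

  nodes-bounded : ∀ {rs} → Forest rs → length (nodes rs) ≤ maxNodes
  nodes-bounded {rs} F = begin
    length (roots ++ children rs)       ≡⟨ length-++ roots ⟩
    length roots + length (children rs) ≡⟨ cong (length roots +_) (length-map _ rs) ⟩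
    length roots + length rs            ≤⟨ +-monoʳ-≤ (length roots) (forest-size roots ∈-roots⁺ F) ⟩
    maxNodes                            ∎
    where open ≤-Reasoning

  formulas-bounded : ∀ {Θ xs} → Invariant Θ → Unique xs → xs ⊆ formulas Θ → length xs ≤ maxFormulas
  formulas-bounded {Θ} {xs} I xs-unique xs⊆Θ = begin
    length xs
      ≤⟨ pigeonhole _≡_ xs-unique (λ x∈ → _ , in-universe I (xs⊆Θ x∈) , refl)
                    (λ _ _ e e′ → trans e (sym e′)) ⟩
    length (universe N)
      ≡⟨ length-universe N ⟩
    length N * (length quasiSubformulas + 4 * length N)
      ≤⟨ *-mono-≤ N≤ (+-monoʳ-≤ (length quasiSubformulas) (*-monoʳ-≤ 4 N≤)) ⟩
    maxFormulas
      ∎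
    where
    open ≤-Reasoning
    N = nodes (diaApps Θ)
    N≤ = nodes-bounded (Invariant.forest I)

  module _ {Θ : ℕ → Branch} (steps : ∀ n → Step root (Θ n) (Θ (suc n))) where

    distinct-formulas : ∀ n → ∃[ xs ] (Unique xs × length xs ≡ n × xs ⊆ formulas (Θ n))
    distinct-formulas zero    = [] , [] , refl , λ ()
    distinct-formulas (suc n) with xs , xs-unique , |xs|≡n , xs⊆ ← distinct-formulas n
                                 | x , x∉Θ , x∈Θ′ ← step-adds (steps n) =
      x ∷ xs , All.tabulate (λ y∈xs → λ { refl → x∉Θ (xs⊆ y∈xs) }) ∷ xs-unique , cong suc |xs|≡n ,
      λ { (here refl) → x∈Θ′ ; (there y∈xs) → step-⊆ (steps n) (xs⊆ y∈xs) }

    invariant-along : Invariant (Θ 0) → ∀ n → Invariant (Θ n)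
    invariant-along I zero    = I
    invariant-along I (suc n) = invariant-step (steps n) (invariant-along I n)

  no-infinite-branch : ¬ InfiniteBranch root
  no-infinite-branch (Θ , Θ₀≡initial , steps) =
    let xs , xs-unique , |xs|≡ , xs⊆ = distinct-formulas steps (suc maxFormulas)
        I = invariant-along steps (subst Invariant (sym Θ₀≡initial) invariant-initial) (suc maxFormulas)
    in 1+n≰n (subst (_≤ maxFormulas) |xs|≡ (formulas-bounded I xs-unique xs⊆))

theorem3 : ∀ (i : Nom) (φ : Form) → ¬ NomIn i φ → ¬ InfiniteBranch (i , φ)
theorem3 i φ _ = Termination.no-infinite-branch i φ
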